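{- Let $m=2n+1\ge 5$ be odd and let $\varphi=(\mathcal A_1,\dots,\mathcal A_m)$ be a ring (as defined in the context). Then the families $\Pi_1,\Pi_2,\dots,\Pi_m$ are pairwise disjoint.
   Context: Indices are taken cyclically modulo $m$. A ring is a sequence $\varphi=(\mathcal A_1,\dots,\mathcal A_m)$ of pairwise disjoint finite vertex sets such that $|\mathcal A_i|\ge 1$ and $|\mathcal A_i|+|\mathcal A_{i+1}|\le m$ for all $i$, and $\sum_{i=1}^m|\mathcal A_i| = m\lfloor m/2\rfloor$. The ring graph has vertex set $\bigcup_i\mathcal A_i$, two distinct vertices $u\in\mathcal A_i$, $v\in\mathcal A_j$ being adjacent iff $j\in\{i-1,i,i+1\}$ mod $m$. For $i=1,\dots,m$, $\Pi_i$ is the family of all sets $\{v_0,v_1,\dots,v_{n-1}\}$ with $v_k\in\mathcal A_{i+2k}$ for $k=0,\dots,n-1$ (one vertex from each of $\mathcal A_i,\mathcal A_{i+2},\dots,\mathcal A_{i+2n-2}$); each such set is an independent set of size $n$. -}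

module Defs where

open import Data.Nat using (ℕ; zero; suc; _+_; _*_; _≤_; _/_)
open import Data.Nat.DivMod using (_mod_)
open import Data.Fin using (Fin; toℕ)
open import Data.List using (List; length; map; allFin)
open import Data.Nat.ListAction using (sum)
open import Data.List.Membership.Propositional using (_∈_)
open import Data.List.Relation.Unary.Unique.Propositional using (Unique)
open import Data.Product using (Σ; ∃; _×_)
open import Relation.Binary.PropositionalEquality using (_≡_; _≢_)
open import Data.Empty using (⊥)
open import Function.Bundles using (_⇔_)

-- Cyclic indexing: indices 1..m of the paper are represented by Fin m (0-based);
-- shift i d = i + d mod m.
shift : ∀ {m} .{{_ : Data.Nat.NonZero m}} → Fin m → ℕ → Fin m
shift {m} i d = (toℕ i + d) mod m

-- A ring φ = (A_1,…,A_m) of vertex sets over a vertex type V.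
-- Each finite vertex set A_i is a duplicate-free list (so |A_i| = length).
record Ring (V : Set) (m : ℕ) .{{_ : Data.Nat.NonZero m}} : Set where
  field
    A        : Fin m → List V
    A-set    : ∀ i → Unique (A i)
    disjoint : ∀ i j → i ≢ j → ∀ v → v ∈ A i → v ∈ A j → ⊥
    nonempty : ∀ i → 1 ≤ length (A i)
    adjSum   : ∀ i → length (A i) + length (A (shift i 1)) ≤ m
    total    : sum (map (λ i → length (A i)) (allFin m)) ≡ m * (m / 2)

-- S ∈ Π_i (with n the number of chosen vertices): S is exactly the set
-- {v_0,…,v_{n-1}} for some choice v_k ∈ A_{i+2k}.  Vertex sets S are predicates on V,
-- compared extensionally.
InΠ : ∀ {V : Set} {m : ℕ} .{{_ : Data.Nat.NonZero m}} →
      Ring V m → (n : ℕ) → Fin m → (V → Set) → Set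
InΠ {V} {m} φ n i S =
  Σ (Fin n → V) λ v →
    (∀ k → v k ∈ Ring.A φ (shift i (2 * toℕ k))) ×
    (∀ u → S u ⇔ ∃ λ k → v k ≡ u)

-- Suppose S lies in both Π_i and Π_j. Its vertex v_0 ∈ A_i is some w_k ∈ A_{j+2k}, and
-- the sets A are disjoint, so j + 2k ≡ i (mod m); symmetrically i + 2l ≡ j. Hence m
-- divides 2(k + l), and as m is odd it divides k + l < 2n < m, so k = l = 0 and i = j.
module Submission where

open import Defs
open import Data.Nat using (ℕ; suc; _*_; _≤_; _+_; _<_; _%_; _/_; s≤s; NonZero)
open import Data.Nat.Properties
  using (+-comm; +-assoc; *-distribˡ-+; +-identityʳ; +-cancelˡ-≡; +-mono-<; <-≤-trans; m<n⇒m<1+n; ≤-reflexive; m+n≡0⇒m≡0)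
open import Data.Nat.DivMod using (m≡m%n+[m/n]*n; %-distribˡ-+; m%n%n≡m%n; m<n⇒m%n≡m; m%n<n)
open import Data.Nat.Divisibility using (_∣_; divides; n∣m⇒m%n≡0; ∣m+n∣m⇒∣n; ∣m⇒∣m*n; ∣1⇒≡1)
open import Data.Nat.Coprimality using (Coprime; coprime-divisor)
open import Data.Fin using (Fin; toℕ; zero)
open import Data.Fin.Properties using (_≟_; toℕ-fromℕ<; toℕ-injective; toℕ<n)
open import Data.List.Membership.Propositional using (_∈_)
open import Data.Product using (_×_; _,_; ∃-syntax)
open import Data.Empty using (⊥; ⊥-elim)
open import Function.Bundles using (Equivalence)
open import Relation.Binary.PropositionalEquality
open import Relation.Nullary using (yes; no)

[m%d+n]%d≡[m+n]%d : ∀ m n d .{{_ : NonZero d}} → (m % d + n) % d ≡ (m + n) % d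
[m%d+n]%d≡[m+n]%d m n d = begin
  (m % d + n) % d         ≡⟨ %-distribˡ-+ (m % d) n d ⟩
  (m % d % d + n % d) % d ≡⟨ cong (λ x → (x + n % d) % d) (m%n%n≡m%n m d) ⟩
  (m % d + n % d) % d     ≡⟨ %-distribˡ-+ m n d ⟨
  (m + n) % d             ∎
  where open ≡-Reasoning

[m+n]%d≡m⇒d∣n : ∀ m n d .{{_ : NonZero d}} → (m + n) % d ≡ m → d ∣ n
[m+n]%d≡m⇒d∣n m n d eq = divides ((m + n) / d) (+-cancelˡ-≡ m n _ (begin
  m + n                           ≡⟨ m≡m%n+[m/n]*n (m + n) d ⟩
  (m + n) % d + (m + n) / d * d   ≡⟨ cong (_+ (m + n) / d * d) eq ⟩
  m + (m + n) / d * d             ∎))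
  where open ≡-Reasoning

∣∧<⇒≡0 : ∀ {d n} .{{_ : NonZero d}} → d ∣ n → n < d → n ≡ 0
∣∧<⇒≡0 {d} {n} d∣n n<d = trans (sym (m<n⇒m%n≡m n<d)) (n∣m⇒m%n≡0 n d d∣n)

odd⇒coprime-2 : ∀ n → Coprime (suc (2 * n)) 2
odd⇒coprime-2 n {e} (e∣odd , e∣2) =
  ∣1⇒≡1 (∣m+n∣m⇒∣n (subst (e ∣_) (+-comm 1 (2 * n)) e∣odd) (∣m⇒∣m*n n e∣2))

round-trip⇒≡ : ∀ {d a b k l} .{{_ : NonZero d}} → Coprime d 2 → b < d → k + l < d →
               (b + 2 * k) % d ≡ a → (a + 2 * l) % d ≡ b → a ≡ b
round-trip⇒≡ {d} {a} {b} {k} {l} d⊥2 b<d k+l<d there back = begin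
  a                 ≡⟨ there ⟨
  (b + 2 * k) % d   ≡⟨ cong (λ x → (b + 2 * x) % d) k≡0 ⟩
  (b + 0) % d       ≡⟨ cong (_% d) (+-identityʳ b) ⟩
  b % d             ≡⟨ m<n⇒m%n≡m b<d ⟩
  b                 ∎
  where
  open ≡-Reasoning
  b+2[k+l]%d≡b : (b + 2 * (k + l)) % d ≡ b
  b+2[k+l]%d≡b = begin
    (b + 2 * (k + l)) % d       ≡⟨ cong (λ x → (b + x) % d) (*-distribˡ-+ 2 k l) ⟩
    (b + (2 * k + 2 * l)) % d   ≡⟨ cong (_% d) (+-assoc b (2 * k) (2 * l)) ⟨
    (b + 2 * k + 2 * l) % d     ≡⟨ [m%d+n]%d≡[m+n]%d (b + 2 * k) (2 * l) d ⟨
    ((b + 2 * k) % d + 2 * l) % d ≡⟨ cong (λ x → (x + 2 * l) % d) there ⟩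
    (a + 2 * l) % d             ≡⟨ back ⟩
    b                           ∎
  k≡0 : k ≡ 0
  k≡0 = m+n≡0⇒m≡0 k (∣∧<⇒≡0 (coprime-divisor d⊥2 ([m+n]%d≡m⇒d∣n b _ d b+2[k+l]%d≡b)) k+l<d)

sum-of-indices< : ∀ {n k l} → k < n → l < n → k + l < suc (2 * n)
sum-of-indices< {n} k<n l<n =
  m<n⇒m<1+n (<-≤-trans (+-mono-< k<n l<n) (≤-reflexive (cong (n +_) (sym (+-identityʳ n)))))

module _ {m : ℕ} .{{_ : NonZero m}} where

  toℕ-shift : ∀ (i : Fin m) d → toℕ (shift i d) ≡ (toℕ i + d) % m
  toℕ-shift i d = toℕ-fromℕ< (m%n<n (toℕ i + d) m)

  shift-zero : ∀ (i : Fin m) → shift i 0 ≡ i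
  shift-zero i = toℕ-injective (begin
    toℕ (shift i 0)   ≡⟨ toℕ-shift i 0 ⟩
    (toℕ i + 0) % m   ≡⟨ cong (_% m) (+-identityʳ (toℕ i)) ⟩
    toℕ i % m         ≡⟨ m<n⇒m%n≡m (toℕ<n i) ⟩
    toℕ i             ∎)
    where open ≡-Reasoning

module _ {V : Set} {m : ℕ} .{{_ : NonZero m}} (φ : Ring V m) where
  open Ring φ

  ∈-A-injective : ∀ {i j u} → u ∈ A i → u ∈ A j → i ≡ j
  ∈-A-injective {i} {j} u∈Ai u∈Aj with i ≟ j
  ... | yes i≡j = i≡j
  ... | no i≢j = ⊥-elim (disjoint i j i≢j _ u∈Ai u∈Aj)

  Π-first-vertex : ∀ {n} i j {S} → InΠ φ (suc n) i S → InΠ φ (suc n) j S →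
                   ∃[ k ] shift j (2 * toℕ k) ≡ i
  Π-first-vertex i j {S} (v , v∈A , S≡v) (w , w∈A , S≡w) =
    let k , w[k]≡v₀ = Equivalence.to (S≡w (v zero)) v₀∈S
        v₀∈A[j+2k] = subst (_∈ A (shift j (2 * toℕ k))) w[k]≡v₀ (w∈A k)
    in  k , trans (∈-A-injective v₀∈A[j+2k] (v∈A zero)) (shift-zero i)
    where
    v₀∈S : S (v zero)
    v₀∈S = Equivalence.from (S≡v (v zero)) (zero , refl)

proposition2p9 : (n : ℕ) → 2 ≤ n → (V : Set) → (φ : Ring V (suc (2 * n))) →
    (i j : Fin (suc (2 * n))) → i ≢ j → (S : V → Set) →
    InΠ φ n i S × InΠ φ n j S → ⊥
proposition2p9 n (s≤s _) V φ i j i≢j S (S∈Πi , S∈Πj)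
  with Π-first-vertex φ i j S∈Πi S∈Πj | Π-first-vertex φ j i S∈Πj S∈Πi
... | k , j+2k≡i | l , i+2l≡j = i≢j (toℕ-injective i≡j)
  where
  i≡j : toℕ i ≡ toℕ j
  i≡j = round-trip⇒≡ {k = toℕ k} {l = toℕ l} (odd⇒coprime-2 n) (toℕ<n j)
          (sum-of-indices< (toℕ<n k) (toℕ<n l))
          (trans (sym (toℕ-shift j (2 * toℕ k))) (cong toℕ j+2k≡i))
          (trans (sym (toℕ-shift i (2 * toℕ l))) (cong toℕ i+2l≡j))
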